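{- Let $q>2$ be a natural number and let $G$ be a simple graph on $q^2+q$ vertices that contains no cycle of length $4$ as a subgraph and has at least $\frac{1}{2}q(q+1)^2-q$ edges. Then every vertex of $G$ has degree at most $q+2$. -}

module Defs where

open import Data.Nat using (ℕ; _+_; _<_)
open import Data.Bool using (Bool; true; false)
open import Data.Fin using (Fin; toℕ)
open import Data.List using (List; length; filter; concatMap)
open import Relation.Binary.PropositionalEquality using (_≡_; _≢_)
open import Relation.Nullary using (¬_)
open import Data.Product using (_×_)
open import Data.Fin.Properties using () renaming (_<?_ to _<ᶠ?_)
open import Data.Bool.Properties using () renaming (_≟_ to _≟ᵇ_)
open import Data.Product using (_,_; proj₁; proj₂)
open import Data.List using (allFin)

record SimpleGraph (n : ℕ) : Set where
  field
    adj       : Fin n → Fin n → Bool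
    symmetric : ∀ i j → adj i j ≡ adj j i
    loopless  : ∀ i → adj i i ≡ false

open SimpleGraph public

_~[_]_ : ∀ {n} → Fin n → SimpleGraph n → Fin n → Set
i ~[ G ] j = adj G i j ≡ true

degree : ∀ {n} → SimpleGraph n → Fin n → ℕ
degree {n} G v = length (filter (λ w → adj G v w ≟ᵇ true) (allFin n))

edgeCount : ∀ {n} → SimpleGraph n → ℕ
edgeCount {n} G =
  length (filter (λ p → adj G (proj₁ p) (proj₂ p) ≟ᵇ true)
           (filter (λ p → proj₁ p <ᶠ? proj₂ p)
             (concatMap (λ i → Data.List.map (λ j → (i , j)) (allFin n)) (allFin n))))

HasC4 : ∀ {n} → SimpleGraph n → Set
HasC4 {n} G =
  Data.Product.Σ (Fin n) λ a → Data.Product.Σ (Fin n) λ b →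
  Data.Product.Σ (Fin n) λ c → Data.Product.Σ (Fin n) λ d →
    (a ≢ b) × (a ≢ c) × (a ≢ d) × (b ≢ c) × (b ≢ d) × (c ≢ d) ×
    (a ~[ G ] b) × (b ~[ G ] c) × (c ~[ G ] d) × (d ~[ G ] a)

C4Free : ∀ {n} → SimpleGraph n → Set
C4Free G = ¬ HasC4 G

-- Suppose a vertex v has degree D ≥ q + 3; let N be its neighbourhood and R the
-- m = q² + q − 1 − D vertices at distance at least 2, and let dᴿ(c) be the number of
-- neighbours of c in R. In a C4-free graph two distinct vertices have at most one
-- common neighbour. Hence each vertex of N has at most one neighbour in N, each
-- vertex of R at most one in N, and counting paths x − c − y with x, y ∈ R gives
-- Σ_c dᴿ(c)² ≤ m² + Σ_c dᴿ(c). With a = Σ_{c ∈ N} dᴿ(c) and T = Σ_{c ∈ R} dᴿ(c) the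
-- first two facts give 2|E| ≤ 3D + 2a + T and a ≤ m; the tangent-line bounds
-- (2k + 1)d ≤ d² + k(k + 1), at k = q − 1 on R and k = q − 3 on N, make the third
-- linear in T and a. Together with the edge hypothesis this leaves a polynomial
-- inequality in q and m that fails for all m ≤ q² − 4.
module Submission where

open import Defs
open import Data.Nat using (ℕ; zero; suc; _+_; _*_; _≤_; _<_; z≤n; s≤s)
open import Data.Nat.Properties hiding (_≟_; suc-injective)
open import Data.Nat.Tactic.RingSolver using (solve-∀)
open import Data.Nat.ListAction using () renaming (sum to sumˡ)
open import Data.Nat.ListAction.Properties using (sum-++)
open import Algebra.Properties.Semiring.Sum +-*-semiring
  using (sum; sum-syntax; sum-cong-≗; ∑-distrib-+; ∑-comm; *-distribˡ-sum; *-distribʳ-sum)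
open import Data.Bool using (Bool; true; false; not; _∧_; _∨_)
open import Data.Bool.Properties using () renaming (_≟_ to _≟ᵇ_)
open import Data.Fin using (Fin; zero; suc; _≟_)
open import Data.Fin.Properties using (suc-injective) renaming (_<?_ to _<ᶠ?_)
open import Data.List using (List; []; _∷_; _++_; length; filter; map; concatMap; tabulate; allFin)
open import Data.List.Properties using (map-++; map-∘)
open import Data.Product using (_×_; _,_; proj₁; proj₂)
open import Data.Empty using (⊥; ⊥-elim)
open import Function using (_∘_)
open import Relation.Nullary using (Dec; yes; no; does)
open import Relation.Unary using (Decidable)
open import Relation.Binary.PropositionalEquality

𝟙 : Bool → ℕ
𝟙 true  = 1
𝟙 false = 0

𝟙-idem : ∀ b → 𝟙 b * 𝟙 b ≡ 𝟙 b
𝟙-idem true  = refl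
𝟙-idem false = refl

𝟙-∧ : ∀ a b → 𝟙 (a ∧ b) ≡ 𝟙 a * 𝟙 b
𝟙-∧ true  b = sym (+-identityʳ (𝟙 b))
𝟙-∧ false b = refl

∧≡true : ∀ {a b} → a ∧ b ≡ true → a ≡ true × b ≡ true
∧≡true {true} {true} refl = refl , refl

𝟙-≟true : ∀ b → 𝟙 (does (b ≟ᵇ true)) ≡ 𝟙 b
𝟙-≟true true  = refl
𝟙-≟true false = refl

𝟙-exclusive : ∀ {P Q : Set} (P? : Dec P) (Q? : Dec Q) → (P → Q → ⊥) →
  𝟙 (does P?) + 𝟙 (does Q?) ≤ 1
𝟙-exclusive (yes p) (yes q) p⇒¬q = ⊥-elim (p⇒¬q p q)
𝟙-exclusive (yes _) (no _)  _    = ≤-refl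
𝟙-exclusive (no _)  (yes _) _    = ≤-refl
𝟙-exclusive (no _)  (no _)  _    = z≤n

δ : ∀ {n} → Fin n → Fin n → ℕ
δ x y = 𝟙 (does (x ≟ y))

∑-mono-≤ : ∀ {n} {f g : Fin n → ℕ} → (∀ i → f i ≤ g i) → sum f ≤ sum g
∑-mono-≤ {zero}  f≤g = z≤n
∑-mono-≤ {suc n} f≤g = +-mono-≤ (f≤g zero) (∑-mono-≤ (f≤g ∘ suc))

∑-distrib-+³ : ∀ {n} (f g h : Fin n → ℕ) →
  ∑[ i < n ] (f i + (g i + h i)) ≡ ∑[ i < n ] f i + (∑[ i < n ] g i + ∑[ i < n ] h i)
∑-distrib-+³ f g h = trans (∑-distrib-+ f (λ i → g i + h i)) (cong (sum f +_) (∑-distrib-+ g h))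

∑-zero : ∀ n → ∑[ i < n ] 0 ≡ 0
∑-zero zero    = refl
∑-zero (suc n) = ∑-zero n

∑-one : ∀ n → ∑[ i < n ] 1 ≡ n
∑-one zero    = refl
∑-one (suc n) = cong suc (∑-one n)

∑-δ : ∀ {n} (v : Fin n) (f : Fin n → ℕ) → ∑[ x < n ] (δ x v * f x) ≡ f v
∑-δ {suc n} zero    f = trans (cong₂ _+_ (+-identityʳ (f zero)) (∑-zero n)) (+-identityʳ (f zero))
∑-δ {suc n} (suc v) f = ∑-δ v (f ∘ suc)

∑-𝟙-unique : ∀ {n} (b : Fin n → Bool) →
  (∀ i j → b i ≡ true → b j ≡ true → i ≡ j) → ∑[ i < n ] 𝟙 (b i) ≤ 1
∑-𝟙-unique {zero}  b unique = z≤n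
∑-𝟙-unique {suc n} b unique with b zero in b₀
... | true  = s≤s (≤-reflexive (trans (sum-cong-≗ rest-false) (∑-zero n)))
  where
  rest-false : ∀ i → 𝟙 (b (suc i)) ≡ 0
  rest-false i with b (suc i) in bᵢ
  ... | true  with () ← unique zero (suc i) b₀ bᵢ
  ... | false = refl
... | false = ∑-𝟙-unique (b ∘ suc) (λ i j bᵢ bⱼ → suc-injective (unique (suc i) (suc j) bᵢ bⱼ))

module _ {X : Set} where

  length-filter : ∀ {P : X → Set} (P? : Decidable P) xs →
    length (filter P? xs) ≡ sumˡ (map (𝟙 ∘ does ∘ P?) xs)
  length-filter P? [] = refl
  length-filter P? (x ∷ xs) with does (P? x)
  ... | true  = cong suc (length-filter P? xs)
  ... | false = length-filter P? xs

  sum-map-filter : ∀ {P : X → Set} (P? : Decidable P) (f : X → ℕ) xs →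
    sumˡ (map f (filter P? xs)) ≡ sumˡ (map (λ x → 𝟙 (does (P? x)) * f x) xs)
  sum-map-filter P? f [] = refl
  sum-map-filter P? f (x ∷ xs) with does (P? x)
  ... | true  = cong₂ _+_ (sym (+-identityʳ (f x))) (sum-map-filter P? f xs)
  ... | false = sum-map-filter P? f xs

  sum-map-concatMap : ∀ {B : Set} (f : B → ℕ) (g : X → List B) xs →
    sumˡ (map f (concatMap g xs)) ≡ sumˡ (map (sumˡ ∘ map f ∘ g) xs)
  sum-map-concatMap f g [] = refl
  sum-map-concatMap f g (x ∷ xs) = begin
    sumˡ (map f (g x ++ concatMap g xs))
      ≡⟨ cong sumˡ (map-++ f (g x) (concatMap g xs)) ⟩
    sumˡ (map f (g x) ++ map f (concatMap g xs))
      ≡⟨ sum-++ (map f (g x)) (map f (concatMap g xs)) ⟩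
    sumˡ (map f (g x)) + sumˡ (map f (concatMap g xs))
      ≡⟨ cong (sumˡ (map f (g x)) +_) (sum-map-concatMap f g xs) ⟩
    sumˡ (map f (g x)) + sumˡ (map (sumˡ ∘ map f ∘ g) xs) ∎
    where open ≡-Reasoning

  sum-map-tabulate : ∀ {n} (f : X → ℕ) (g : Fin n → X) →
    sumˡ (map f (tabulate g)) ≡ ∑[ i < n ] f (g i)
  sum-map-tabulate {zero}  f g = refl
  sum-map-tabulate {suc n} f g = cong (f (g zero) +_) (sum-map-tabulate f (g ∘ suc))

-- (d − k)(d − k − 1) ≥ 0 on ℕ.
[2k+1]*d≤d*d+k*[k+1] : ∀ d k → (2 * k + 1) * d ≤ d * d + k * (k + 1)
[2k+1]*d≤d*d+k*[k+1] zero k = ≤-trans (≤-reflexive (*-zeroʳ (2 * k + 1))) z≤n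
[2k+1]*d≤d*d+k*[k+1] (suc d) zero = +-monoˡ-≤ 0 (m≤m*n (suc d) (suc d))
[2k+1]*d≤d*d+k*[k+1] (suc d) (suc k) =
  subst₂ _≤_ (lhs d k) (rhs d k) (+-monoˡ-≤ (2 * d + 2 * k + 3) ([2k+1]*d≤d*d+k*[k+1] d k))
  where
  lhs : ∀ d k → (2 * k + 1) * d + (2 * d + 2 * k + 3) ≡ (2 * suc k + 1) * suc d
  lhs = solve-∀
  rhs : ∀ d k → d * d + k * (k + 1) + (2 * d + 2 * k + 3) ≡ suc d * suc d + suc k * (suc k + 1)
  rhs = solve-∀

∑-tangent : ∀ {n} k (d w : Fin n → ℕ) →
  (2 * k + 1) * ∑[ x < n ] (d x * w x) ≤ ∑[ x < n ] (d x * d x * w x) + k * (k + 1) * ∑[ x < n ] w x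
∑-tangent {n} k d w = begin
  (2 * k + 1) * ∑[ x < n ] (d x * w x)
    ≡⟨ *-distribˡ-sum (2 * k + 1) (λ x → d x * w x) ⟩
  ∑[ x < n ] ((2 * k + 1) * (d x * w x))
    ≤⟨ ∑-mono-≤ pointwise ⟩
  ∑[ x < n ] (d x * d x * w x + k * (k + 1) * w x)
    ≡⟨ ∑-distrib-+ (λ x → d x * d x * w x) (λ x → k * (k + 1) * w x) ⟩
  ∑[ x < n ] (d x * d x * w x) + ∑[ x < n ] (k * (k + 1) * w x)
    ≡⟨ cong (∑[ x < n ] (d x * d x * w x) +_) (sym (*-distribˡ-sum (k * (k + 1)) w)) ⟩
  ∑[ x < n ] (d x * d x * w x) + k * (k + 1) * ∑[ x < n ] w x ∎
  where
  open ≤-Reasoning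
  pointwise : ∀ x → (2 * k + 1) * (d x * w x) ≤ d x * d x * w x + k * (k + 1) * w x
  pointwise x = begin
    (2 * k + 1) * (d x * w x)     ≡⟨ sym (*-assoc (2 * k + 1) (d x) (w x)) ⟩
    (2 * k + 1) * d x * w x       ≤⟨ *-monoˡ-≤ (w x) ([2k+1]*d≤d*d+k*[k+1] (d x) k) ⟩
    (d x * d x + k * (k + 1)) * w x ≡⟨ *-distribʳ-+ (w x) (d x * d x) (k * (k + 1)) ⟩
    d x * d x * w x + k * (k + 1) * w x ∎

*-rotate : ∀ a b c → a * b * c ≡ b * (c * a)
*-rotate = solve-∀

module _ {n : ℕ} (G : SimpleGraph n) where

  A : Fin n → Fin n → ℕ
  A i j = 𝟙 (adj G i j)

  deg : Fin n → ℕ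
  deg i = ∑[ j < n ] A i j

  nbrSum : (Fin n → ℕ) → Fin n → ℕ
  nbrSum g c = ∑[ x < n ] (A c x * g x)

  codegree : Fin n → Fin n → ℕ
  codegree x y = ∑[ c < n ] (A x c * A y c)

  A-sym : ∀ i j → A i j ≡ A j i
  A-sym i j = cong 𝟙 (symmetric G i j)

  A-idem : ∀ i j → A i j * A i j ≡ A i j
  A-idem i j = 𝟙-idem (adj G i j)

  adj⇒≢ : ∀ {i j} → i ~[ G ] j → i ≢ j
  adj⇒≢ {i} i~i refl with () ← trans (sym i~i) (loopless G i)

  degree≡deg : ∀ v → degree G v ≡ deg v
  degree≡deg v = begin
    degree G v
      ≡⟨ length-filter (λ w → adj G v w ≟ᵇ true) (allFin n) ⟩
    sumˡ (map (λ w → 𝟙 (does (adj G v w ≟ᵇ true))) (allFin n))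
      ≡⟨ sum-map-tabulate (λ w → 𝟙 (does (adj G v w ≟ᵇ true))) (λ w → w) ⟩
    ∑[ w < n ] 𝟙 (does (adj G v w ≟ᵇ true))
      ≡⟨ sum-cong-≗ (λ w → 𝟙-≟true (adj G v w)) ⟩
    deg v ∎
    where open ≡-Reasoning

  lt : Fin n → Fin n → ℕ
  lt i j = 𝟙 (does (i <ᶠ? j))

  lt-asym : ∀ i j → lt i j + lt j i ≤ 1
  lt-asym i j = 𝟙-exclusive (i <ᶠ? j) (j <ᶠ? i) <-asym

  edgeCount≡∑ : edgeCount G ≡ ∑[ i < n ] ∑[ j < n ] (lt i j * A i j)
  edgeCount≡∑ = begin
    edgeCount G
      ≡⟨ length-filter edge? (filter ordered? pairs) ⟩
    sumˡ (map (𝟙 ∘ does ∘ edge?) (filter ordered? pairs))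
      ≡⟨ sum-map-filter ordered? (𝟙 ∘ does ∘ edge?) pairs ⟩
    sumˡ (map h pairs)
      ≡⟨ sum-map-concatMap h row (allFin n) ⟩
    sumˡ (map (sumˡ ∘ map h ∘ row) (allFin n))
      ≡⟨ sum-map-tabulate (sumˡ ∘ map h ∘ row) (λ i → i) ⟩
    ∑[ i < n ] sumˡ (map h (row i))
      ≡⟨ sum-cong-≗ (λ i → trans (cong sumˡ (sym (map-∘ (allFin n))))
                                  (sum-map-tabulate (λ j → h (i , j)) (λ j → j))) ⟩
    ∑[ i < n ] ∑[ j < n ] h (i , j)
      ≡⟨ sum-cong-≗ (λ i → sum-cong-≗ (λ j → cong (lt i j *_) (𝟙-≟true (adj G i j)))) ⟩
    ∑[ i < n ] ∑[ j < n ] (lt i j * A i j) ∎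
    where
    open ≡-Reasoning
    edge? : (p : Fin n × Fin n) → Dec (adj G (proj₁ p) (proj₂ p) ≡ true)
    edge? p = adj G (proj₁ p) (proj₂ p) ≟ᵇ true
    ordered? : (p : Fin n × Fin n) → Dec (proj₁ p Data.Fin.< proj₂ p)
    ordered? p = proj₁ p <ᶠ? proj₂ p
    row : Fin n → List (Fin n × Fin n)
    row i = map (λ j → (i , j)) (allFin n)
    pairs : List (Fin n × Fin n)
    pairs = concatMap row (allFin n)
    h : Fin n × Fin n → ℕ
    h p = 𝟙 (does (ordered? p)) * 𝟙 (does (edge? p))

  2*edgeCount≤∑deg : 2 * edgeCount G ≤ ∑[ i < n ] deg i
  2*edgeCount≤∑deg = begin
    2 * edgeCount G
      ≡⟨ cong (2 *_) edgeCount≡∑ ⟩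
    E + (E + 0)
      ≡⟨ cong (E +_) (trans (+-identityʳ E) (∑-comm (λ i j → lt i j * A i j))) ⟩
    E + ∑[ i < n ] ∑[ j < n ] (lt j i * A j i)
      ≡⟨ cong (E +_) (sum-cong-≗ (λ i → sum-cong-≗ (λ j → cong (lt j i *_) (A-sym j i)))) ⟩
    E + ∑[ i < n ] ∑[ j < n ] (lt j i * A i j)
      ≡⟨ sym (∑-distrib-+ (λ i → ∑[ j < n ] (lt i j * A i j)) (λ i → ∑[ j < n ] (lt j i * A i j))) ⟩
    ∑[ i < n ] (∑[ j < n ] (lt i j * A i j) + ∑[ j < n ] (lt j i * A i j))
      ≡⟨ sum-cong-≗ (λ i → sym (∑-distrib-+ (λ j → lt i j * A i j) (λ j → lt j i * A i j))) ⟩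
    ∑[ i < n ] ∑[ j < n ] (lt i j * A i j + lt j i * A i j)
      ≤⟨ ∑-mono-≤ (λ i → ∑-mono-≤ (λ j → each-edge-once i j)) ⟩
    ∑[ i < n ] deg i ∎
    where
    open ≤-Reasoning
    E : ℕ
    E = ∑[ i < n ] ∑[ j < n ] (lt i j * A i j)
    each-edge-once : ∀ i j → lt i j * A i j + lt j i * A i j ≤ A i j
    each-edge-once i j = begin
      lt i j * A i j + lt j i * A i j ≡⟨ sym (*-distribʳ-+ (A i j) (lt i j) (lt j i)) ⟩
      (lt i j + lt j i) * A i j       ≤⟨ *-monoˡ-≤ (A i j) (lt-asym i j) ⟩
      A i j + 0                       ≡⟨ +-identityʳ (A i j) ⟩
      A i j                           ∎

  ∑-nbrSum : ∀ g → ∑[ c < n ] nbrSum g c ≡ ∑[ x < n ] (deg x * g x)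
  ∑-nbrSum g = begin
    ∑[ c < n ] ∑[ x < n ] (A c x * g x)  ≡⟨ ∑-comm (λ c x → A c x * g x) ⟩
    ∑[ x < n ] ∑[ c < n ] (A c x * g x)  ≡⟨ sum-cong-≗ (λ x → sym (*-distribʳ-sum (g x) (λ c → A c x))) ⟩
    ∑[ x < n ] (∑[ c < n ] A c x * g x)  ≡⟨ sum-cong-≗ (λ x → cong (_* g x) (sum-cong-≗ (λ c → A-sym c x))) ⟩
    ∑[ x < n ] (deg x * g x)             ∎
    where open ≡-Reasoning

  ∑-nbrSum*A : ∀ g x → ∑[ c < n ] (nbrSum g c * A x c) ≡ ∑[ y < n ] (g y * codegree x y)
  ∑-nbrSum*A g x = begin
    ∑[ c < n ] (∑[ y < n ] (A c y * g y) * A x c)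
      ≡⟨ sum-cong-≗ (λ c → *-distribʳ-sum (A x c) (λ y → A c y * g y)) ⟩
    ∑[ c < n ] ∑[ y < n ] (A c y * g y * A x c)
      ≡⟨ ∑-comm (λ c y → A c y * g y * A x c) ⟩
    ∑[ y < n ] ∑[ c < n ] (A c y * g y * A x c)
      ≡⟨ sum-cong-≗ (λ y → sum-cong-≗ (λ c →
           trans (cong (λ a → a * g y * A x c) (A-sym c y)) (*-rotate (A y c) (g y) (A x c)))) ⟩
    ∑[ y < n ] ∑[ c < n ] (g y * (A x c * A y c))
      ≡⟨ sum-cong-≗ (λ y → sym (*-distribˡ-sum (g y) (λ c → A x c * A y c))) ⟩
    ∑[ y < n ] (g y * codegree x y) ∎
    where open ≡-Reasoning

  ∑-nbrSum² : ∀ g → ∑[ c < n ] (nbrSum g c * nbrSum g c) ≡ ∑[ x < n ] (g x * ∑[ y < n ] (g y * codegree x y))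
  ∑-nbrSum² g = begin
    ∑[ c < n ] (∑[ x < n ] (A c x * g x) * nbrSum g c)
      ≡⟨ sum-cong-≗ (λ c → *-distribʳ-sum (nbrSum g c) (λ x → A c x * g x)) ⟩
    ∑[ c < n ] ∑[ x < n ] (A c x * g x * nbrSum g c)
      ≡⟨ ∑-comm (λ c x → A c x * g x * nbrSum g c) ⟩
    ∑[ x < n ] ∑[ c < n ] (A c x * g x * nbrSum g c)
      ≡⟨ sum-cong-≗ (λ x → sum-cong-≗ (λ c →
           trans (cong (λ a → a * g x * nbrSum g c) (A-sym c x)) (*-rotate (A x c) (g x) (nbrSum g c)))) ⟩
    ∑[ x < n ] ∑[ c < n ] (g x * (nbrSum g c * A x c))
      ≡⟨ sum-cong-≗ (λ x → sym (*-distribˡ-sum (g x) (λ c → nbrSum g c * A x c))) ⟩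
    ∑[ x < n ] (g x * ∑[ c < n ] (nbrSum g c * A x c))
      ≡⟨ sum-cong-≗ (λ x → cong (g x *_) (∑-nbrSum*A g x)) ⟩
    ∑[ x < n ] (g x * ∑[ y < n ] (g y * codegree x y)) ∎
    where open ≡-Reasoning

  codegree-diag : ∀ x → codegree x x ≡ deg x
  codegree-diag x = sum-cong-≗ (A-idem x)

  codegree≤1 : C4Free G → ∀ {x y} → x ≢ y → codegree x y ≤ 1
  codegree≤1 free {x} {y} x≢y =
    subst (_≤ 1) (sum-cong-≗ (λ c → 𝟙-∧ (adj G x c) (adj G y c)))
          (∑-𝟙-unique (λ c → adj G x c ∧ adj G y c) unique)
    where
    unique : ∀ c c′ → adj G x c ∧ adj G y c ≡ true → adj G x c′ ∧ adj G y c′ ≡ true → c ≡ c′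
    unique c c′ xcy xc′y with c ≟ c′ | ∧≡true xcy | ∧≡true xc′y
    ... | yes c≡c′ | _ | _ = c≡c′
    ... | no c≢c′ | x~c , y~c | x~c′ , y~c′ = ⊥-elim (free
      ( x , c , y , c′
      , adj⇒≢ x~c , x≢y , adj⇒≢ x~c′ , adj⇒≢ c~y , c≢c′ , adj⇒≢ y~c′
      , x~c , c~y , y~c′ , trans (symmetric G c′ x) x~c′ ))
      where
      c~y : c ~[ G ] y
      c~y = trans (symmetric G c y) y~c

  -- Off the diagonal a codegree is at most 1; on it, it is the degree.
  ∑-*codegree≤ : C4Free G → ∀ g x → ∑[ y < n ] (g y * codegree x y) ≤ ∑[ y < n ] g y + g x * deg x
  ∑-*codegree≤ free g x = begin
    ∑[ y < n ] (g y * codegree x y)            ≤⟨ ∑-mono-≤ pointwise ⟩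
    ∑[ y < n ] (g y + δ y x * (g y * deg x))   ≡⟨ ∑-distrib-+ g (λ y → δ y x * (g y * deg x)) ⟩
    ∑[ y < n ] g y + ∑[ y < n ] (δ y x * (g y * deg x))
                                               ≡⟨ cong (∑[ y < n ] g y +_) (∑-δ x (λ y → g y * deg x)) ⟩
    ∑[ y < n ] g y + g x * deg x               ∎
    where
    open ≤-Reasoning
    pointwise : ∀ y → g y * codegree x y ≤ g y + δ y x * (g y * deg x)
    pointwise y with y ≟ x
    ... | yes refl = begin
      g x * codegree x x     ≡⟨ cong (g x *_) (codegree-diag x) ⟩
      g x * deg x            ≤⟨ m≤n+m (g x * deg x) (g x) ⟩
      g x + g x * deg x      ≡⟨ cong (g x +_) (sym (+-identityʳ (g x * deg x))) ⟩
      g x + 1 * (g x * deg x) ∎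
    ... | no y≢x = begin
      g y * codegree x y     ≤⟨ *-monoʳ-≤ (g y) (codegree≤1 free (y≢x ∘ sym)) ⟩
      g y * 1                ≡⟨ *-identityʳ (g y) ⟩
      g y                    ≡⟨ sym (+-identityʳ (g y)) ⟩
      g y + 0                ∎

  ∑-nbrSum²≤ : C4Free G → ∀ g →
    ∑[ c < n ] (nbrSum g c * nbrSum g c) ≤ ∑[ x < n ] g x * ∑[ x < n ] g x + ∑[ x < n ] (g x * (g x * deg x))
  ∑-nbrSum²≤ free g = begin
    ∑[ c < n ] (nbrSum g c * nbrSum g c)
      ≡⟨ ∑-nbrSum² g ⟩
    ∑[ x < n ] (g x * ∑[ y < n ] (g y * codegree x y))
      ≤⟨ ∑-mono-≤ (λ x → *-monoʳ-≤ (g x) (∑-*codegree≤ free g x)) ⟩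
    ∑[ x < n ] (g x * (∑g + g x * deg x))
      ≡⟨ sum-cong-≗ (λ x → *-distribˡ-+ (g x) ∑g (g x * deg x)) ⟩
    ∑[ x < n ] (g x * ∑g + g x * (g x * deg x))
      ≡⟨ ∑-distrib-+ (λ x → g x * ∑g) (λ x → g x * (g x * deg x)) ⟩
    ∑[ x < n ] (g x * ∑g) + ∑[ x < n ] (g x * (g x * deg x))
      ≡⟨ cong (_+ ∑[ x < n ] (g x * (g x * deg x))) (sym (*-distribʳ-sum ∑g g)) ⟩
    ∑g * ∑g + ∑[ x < n ] (g x * (g x * deg x)) ∎
    where
    open ≤-Reasoning
    ∑g : ℕ
    ∑g = ∑[ x < n ] g x

-- N and R are the indicators of the neighbours of v and of the other non-neighbours
-- of v; dᴿ c counts the neighbours of c in R, so a counts the edges between N and R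
-- and T is twice the number of edges inside R.
module Neighbourhood {n : ℕ} (G : SimpleGraph n) (v : Fin n) where

  N R : Fin n → ℕ
  N x = A G v x
  R x = 𝟙 (not (adj G v x ∨ does (x ≟ v)))

  δ+N+R≡1 : ∀ x → δ x v + (N x + R x) ≡ 1
  δ+N+R≡1 x with x ≟ v
  ... | yes refl rewrite loopless G v = refl
  ... | no _ with adj G v x
  ...   | true  = refl
  ...   | false = refl

  N-v : N v ≡ 0
  N-v = cong 𝟙 (loopless G v)

  R-v : R v ≡ 0
  R-v rewrite loopless G v with v ≟ v
  ... | yes _   = refl
  ... | no v≢v = ⊥-elim (v≢v refl)

  R-idem : ∀ x → R x * R x ≡ R x
  R-idem x = 𝟙-idem (not (adj G v x ∨ does (x ≟ v)))

  N*R≡0 : ∀ x → N x * R x ≡ 0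
  N*R≡0 x with adj G v x
  ... | true  = refl
  ... | false = refl

  ∑-split : ∀ f → ∑[ x < n ] f x ≡ f v + (∑[ x < n ] (f x * N x) + ∑[ x < n ] (f x * R x))
  ∑-split f = begin
    ∑[ x < n ] f x
      ≡⟨ sum-cong-≗ (λ x → trans (sym (*-identityʳ (f x))) (trans (cong (f x *_) (sym (δ+N+R≡1 x)))
                                   (spread (f x) (δ x v) (N x) (R x)))) ⟩
    ∑[ x < n ] (δ x v * f x + (f x * N x + f x * R x))
      ≡⟨ ∑-distrib-+³ (λ x → δ x v * f x) (λ x → f x * N x) (λ x → f x * R x) ⟩
    ∑[ x < n ] (δ x v * f x) + (∑[ x < n ] (f x * N x) + ∑[ x < n ] (f x * R x))
      ≡⟨ cong (_+ (∑[ x < n ] (f x * N x) + ∑[ x < n ] (f x * R x))) (∑-δ v f) ⟩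
    f v + (∑[ x < n ] (f x * N x) + ∑[ x < n ] (f x * R x)) ∎
    where
    open ≡-Reasoning
    spread : ∀ f d a r → f * (d + (a + r)) ≡ d * f + (f * a + f * r)
    spread = solve-∀

  dᴿ : Fin n → ℕ
  dᴿ = nbrSum G R

  m a T : ℕ
  m = ∑[ x < n ] R x
  a = ∑[ c < n ] (dᴿ c * N c)
  T = ∑[ c < n ] (dᴿ c * R c)

  1+deg+m≡n : 1 + (deg G v + m) ≡ n
  1+deg+m≡n = begin
    1 + (deg G v + m)
      ≡⟨ cong₂ (λ D r → 1 + (D + r)) (sum-cong-≗ (λ x → sym (*-identityˡ (N x))))
                                     (sum-cong-≗ (λ x → sym (*-identityˡ (R x)))) ⟩
    1 + (∑[ x < n ] (1 * N x) + ∑[ x < n ] (1 * R x))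
      ≡⟨ sym (∑-split (λ _ → 1)) ⟩
    ∑[ x < n ] 1
      ≡⟨ ∑-one n ⟩
    n ∎
    where open ≡-Reasoning

  ∑dᴿ≡a+T : ∑[ c < n ] dᴿ c ≡ a + T
  ∑dᴿ≡a+T = trans (∑-split dᴿ) (cong (_+ (a + T)) (trans (sum-cong-≗ N*R≡0) (∑-zero n)))

  a≤m : C4Free G → a ≤ m
  a≤m free = begin
    a                                 ≡⟨ ∑-nbrSum*A G R v ⟩
    ∑[ y < n ] (R y * codegree G v y) ≤⟨ ∑-*codegree≤ G free R v ⟩
    m + R v * deg G v                 ≡⟨ cong (λ r → m + r * deg G v) R-v ⟩
    m + 0                             ≡⟨ +-identityʳ m ⟩
    m                                 ∎
    where open ≤-Reasoning

  ∑deg*N≤2deg+a : C4Free G → ∑[ x < n ] (deg G x * N x) ≤ deg G v + (deg G v + a)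
  ∑deg*N≤2deg+a free = begin
    ∑[ x < n ] (deg G x * N x)
      ≡⟨ sum-cong-≗ (λ x → trans (cong (_* N x) (∑-split (A G x)))
                                  (*-distribʳ-+³ (A G x v) (nbrSum G N x) (dᴿ x) (N x))) ⟩
    ∑[ x < n ] (A G x v * N x + (nbrSum G N x * N x + dᴿ x * N x))
      ≡⟨ ∑-distrib-+³ (λ x → A G x v * N x) (λ x → nbrSum G N x * N x) (λ x → dᴿ x * N x) ⟩
    ∑[ x < n ] (A G x v * N x) + (∑[ x < n ] (nbrSum G N x * N x) + a)
      ≤⟨ +-mono-≤ (≤-reflexive (sum-cong-≗ A*N≡N)) (+-monoˡ-≤ a N-codegree) ⟩
    deg G v + (deg G v + a) ∎
    where
    open ≤-Reasoning
    *-distribʳ-+³ : ∀ x y z w → (x + (y + z)) * w ≡ x * w + (y * w + z * w)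
    *-distribʳ-+³ = solve-∀
    A*N≡N : ∀ x → A G x v * N x ≡ N x
    A*N≡N x = trans (cong (_* N x) (A-sym G x v)) (A-idem G v x)
    N-codegree : ∑[ x < n ] (nbrSum G N x * N x) ≤ deg G v
    N-codegree = begin
      ∑[ x < n ] (nbrSum G N x * N x)   ≡⟨ ∑-nbrSum*A G N v ⟩
      ∑[ y < n ] (N y * codegree G v y) ≤⟨ ∑-*codegree≤ G free N v ⟩
      deg G v + N v * deg G v           ≡⟨ cong (λ r → deg G v + r * deg G v) N-v ⟩
      deg G v + 0                       ≡⟨ +-identityʳ (deg G v) ⟩
      deg G v                           ∎

  ∑deg≤3deg+2a+T : C4Free G → ∑[ c < n ] deg G c ≤ 3 * deg G v + 2 * a + T
  ∑deg≤3deg+2a+T free = begin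
    ∑[ c < n ] deg G c
      ≡⟨ sum-cong-≗ (λ c → ∑-split (A G c)) ⟩
    ∑[ c < n ] (A G c v + (nbrSum G N c + dᴿ c))
      ≡⟨ ∑-distrib-+³ (λ c → A G c v) (nbrSum G N) dᴿ ⟩
    ∑[ c < n ] A G c v + (∑[ c < n ] nbrSum G N c + ∑[ c < n ] dᴿ c)
      ≡⟨ cong₂ (λ D s → D + (s + ∑[ c < n ] dᴿ c)) (sum-cong-≗ (λ c → A-sym G c v)) (∑-nbrSum G N) ⟩
    deg G v + (∑[ x < n ] (deg G x * N x) + ∑[ c < n ] dᴿ c)
      ≤⟨ +-monoʳ-≤ (deg G v) (+-mono-≤ (∑deg*N≤2deg+a free) (≤-reflexive ∑dᴿ≡a+T)) ⟩
    deg G v + ((deg G v + (deg G v + a)) + (a + T))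
      ≡⟨ collect (deg G v) a T ⟩
    3 * deg G v + 2 * a + T ∎
    where
    open ≤-Reasoning
    collect : ∀ D a T → D + ((D + (D + a)) + (a + T)) ≡ 3 * D + 2 * a + T
    collect = solve-∀

  ∑dᴿ²≤m²+a+T : C4Free G → ∑[ c < n ] (dᴿ c * dᴿ c) ≤ m * m + (a + T)
  ∑dᴿ²≤m²+a+T free = begin
    ∑[ c < n ] (dᴿ c * dᴿ c)                      ≤⟨ ∑-nbrSum²≤ G free R ⟩
    m * m + ∑[ x < n ] (R x * (R x * deg G x))
      ≡⟨ cong (m * m +_) (sum-cong-≗ (λ x → trans (sym (*-assoc (R x) (R x) (deg G x)))
           (trans (cong (_* deg G x) (R-idem x)) (*-comm (R x) (deg G x))))) ⟩
    m * m + ∑[ x < n ] (deg G x * R x)           ≡⟨ cong (m * m +_) (sym (∑-nbrSum G R)) ⟩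
    m * m + ∑[ c < n ] dᴿ c                      ≡⟨ cong (m * m +_) ∑dᴿ≡a+T ⟩
    m * m + (a + T)                              ∎
    where open ≤-Reasoning

  tangent-bound : C4Free G → ∀ k j →
    (2 * k + 1) * T + (2 * j + 1) * a ≤ m * m + (a + T) + k * (k + 1) * m + j * (j + 1) * deg G v
  tangent-bound free k j = begin
    (2 * k + 1) * T + (2 * j + 1) * a
      ≤⟨ +-mono-≤ (∑-tangent k dᴿ R) (∑-tangent j dᴿ N) ⟩
    (∑d²R + k * (k + 1) * m) + (∑d²N + j * (j + 1) * deg G v)
      ≡⟨ shuffle ∑d²R (k * (k + 1) * m) ∑d²N (j * (j + 1) * deg G v) ⟩
    (∑d²N + ∑d²R) + k * (k + 1) * m + j * (j + 1) * deg G v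
      ≤⟨ +-monoˡ-≤ _ (+-monoˡ-≤ _ (≤-trans ∑d²N+∑d²R≤∑d² (∑dᴿ²≤m²+a+T free))) ⟩
    m * m + (a + T) + k * (k + 1) * m + j * (j + 1) * deg G v ∎
    where
    open ≤-Reasoning
    ∑d²N ∑d²R : ℕ
    ∑d²N = ∑[ c < n ] (dᴿ c * dᴿ c * N c)
    ∑d²R = ∑[ c < n ] (dᴿ c * dᴿ c * R c)
    shuffle : ∀ x y z w → (x + y) + (z + w) ≡ (z + x) + y + w
    shuffle = solve-∀
    ∑d²N+∑d²R≤∑d² : ∑d²N + ∑d²R ≤ ∑[ c < n ] (dᴿ c * dᴿ c)
    ∑d²N+∑d²R≤∑d² = subst (∑d²N + ∑d²R ≤_) (sym (∑-split (λ c → dᴿ c * dᴿ c))) (m≤n+m (∑d²N + ∑d²R) (dᴿ v * dᴿ v))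

-- Here q = 3 + p. Adding 2(q − 1) times the edge bound to the tangent bound
-- eliminates T, and a ≤ m leaves a bound increasing in m; at the largest value
-- m = q² − 4 allowed by D ≥ q + 3 it still falls short by 3q − 8 > 0.
high-degree-impossible : ∀ p D m a T →
  3 + p + 2 < D →
  1 + (D + m) ≡ (3 + p) * (3 + p) + (3 + p) →
  a ≤ m →
  (3 + p) * ((3 + p + 1) * (3 + p + 1)) ≤ 3 * D + 2 * a + T + 2 * (3 + p) →
  (2 * (2 + p) + 1) * T + (2 * p + 1) * a ≤ m * m + (a + T) + (2 + p) * (2 + p + 1) * m + p * (p + 1) * D →
  ⊥
high-degree-impossible p D m a T high count a≤m edges tangent = m+1+n≰m bound (begin
  bound + suc (3 * p)
    ≡⟨ excess p ⟩
  2 * k * L + s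
    ≤⟨ +-monoˡ-≤ s eliminated ⟩
  m * m + k * (k + 1) * m + p * (p + 1) * D + ((2 * p + 8) * m + 2 * k * (3 * D + 2 * q)) + s
    ≡⟨ regroup p D m ⟩
  m * m + 2 * m + s * (1 + (D + m)) + 4 * k * q
    ≡⟨ cong (λ z → m * m + 2 * m + s * z + 4 * k * q) count ⟩
  m * m + 2 * m + s * s + 4 * k * q
    ≤⟨ +-monoˡ-≤ (4 * k * q) (+-monoˡ-≤ (s * s) (+-mono-≤ (*-mono-≤ m≤r m≤r) (*-monoʳ-≤ 2 m≤r))) ⟩
  bound ∎)
  where
  open ≤-Reasoning
  q k s r L bound : ℕ
  q = 3 + p
  k = 2 + p
  s = q * q + q
  r = p * p + 6 * p + 5
  L = q * ((q + 1) * (q + 1))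
  bound = r * r + 2 * r + s * s + 4 * k * q

  m≤r : m ≤ r
  m≤r = +-cancelˡ-≤ (p + 7) m r (begin
    p + 7 + m          ≡⟨ shift p m ⟩
    1 + (suc (3 + p + 2) + m) ≤⟨ +-monoʳ-≤ 1 (+-monoˡ-≤ m high) ⟩
    1 + (D + m)        ≡⟨ count ⟩
    s                  ≡⟨ square p ⟩
    p + 7 + r          ∎)
    where
    shift : ∀ p m → p + 7 + m ≡ 1 + (suc (3 + p + 2) + m)
    shift = solve-∀
    square : ∀ p → (3 + p) * (3 + p) + (3 + p) ≡ p + 7 + (p * p + 6 * p + 5)
    square = solve-∀

  tangent′ : 2 * k * T + 2 * p * a ≤ m * m + k * (k + 1) * m + p * (p + 1) * D
  tangent′ = +-cancelʳ-≤ (a + T) _ _ (subst₂ _≤_ (split p a T) (split′ m a T (k * (k + 1) * m) (p * (p + 1) * D)) tangent)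
    where
    split : ∀ p a T → (2 * (2 + p) + 1) * T + (2 * p + 1) * a ≡ 2 * (2 + p) * T + 2 * p * a + (a + T)
    split = solve-∀
    split′ : ∀ m a T x y → m * m + (a + T) + x + y ≡ m * m + x + y + (a + T)
    split′ = solve-∀

  eliminated : 2 * k * L ≤ m * m + k * (k + 1) * m + p * (p + 1) * D + ((2 * p + 8) * m + 2 * k * (3 * D + 2 * q))
  eliminated = begin
    2 * k * L                                ≤⟨ *-monoʳ-≤ (2 * k) edges ⟩
    2 * k * (3 * D + 2 * a + T + 2 * q)      ≡⟨ expand p D a T ⟩
    (2 * k * T + 2 * p * a) + ((2 * p + 8) * a + 2 * k * (3 * D + 2 * q))
      ≤⟨ +-mono-≤ tangent′ (+-monoˡ-≤ (2 * k * (3 * D + 2 * q)) (*-monoʳ-≤ (2 * p + 8) a≤m)) ⟩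
    m * m + k * (k + 1) * m + p * (p + 1) * D + ((2 * p + 8) * m + 2 * k * (3 * D + 2 * q)) ∎
    where
    expand : ∀ p D a T → 2 * (2 + p) * (3 * D + 2 * a + T + 2 * (3 + p))
      ≡ (2 * (2 + p) * T + 2 * p * a) + ((2 * p + 8) * a + 2 * (2 + p) * (3 * D + 2 * (3 + p)))
    expand = solve-∀

  regroup : ∀ p D m →
    m * m + (2 + p) * (2 + p + 1) * m + p * (p + 1) * D + ((2 * p + 8) * m + 2 * (2 + p) * (3 * D + 2 * (3 + p)))
      + ((3 + p) * (3 + p) + (3 + p))
    ≡ m * m + 2 * m + ((3 + p) * (3 + p) + (3 + p)) * (1 + (D + m)) + 4 * (2 + p) * (3 + p)
  regroup = solve-∀

  excess : ∀ p →
    (p * p + 6 * p + 5) * (p * p + 6 * p + 5) + 2 * (p * p + 6 * p + 5)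
      + ((3 + p) * (3 + p) + (3 + p)) * ((3 + p) * (3 + p) + (3 + p)) + 4 * (2 + p) * (3 + p) + suc (3 * p)
    ≡ 2 * (2 + p) * ((3 + p) * ((3 + p + 1) * (3 + p + 1))) + ((3 + p) * (3 + p) + (3 + p))
  excess = solve-∀

mainTheorem2 : (q : ℕ) → 2 < q → (G : SimpleGraph (q * q + q)) → C4Free G →
    q * ((q + 1) * (q + 1)) ≤ 2 * edgeCount G + 2 * q →
    (v : Fin (q * q + q)) → degree G v ≤ q + 2
mainTheorem2 (suc (suc (suc p))) _ G free many v = ≮⇒≥ λ big →
  high-degree-impossible p (deg G v) m a T
    (subst (3 + p + 2 <_) (degree≡deg G v) big)
    1+deg+m≡n
    (a≤m free)
    (≤-trans many (+-monoˡ-≤ (2 * (3 + p)) (≤-trans (2*edgeCount≤∑deg G) (∑deg≤3deg+2a+T free))))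
    (tangent-bound free (2 + p) p)
  where open Neighbourhood G v
mainTheorem2 1 (s≤s ())
mainTheorem2 2 (s≤s (s≤s ()))
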